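{- For every $n\ge0$, $|\operatorname{Sort}_n(\operatorname{SC}_{321})|=M_n$, the $n$th Motzkin number.
   Context: $S_n$ is the set of permutations of $[n]$ in one-line notation ($S_0$ contains only the empty permutation). Two sequences of distinct integers have the same relative order if replacing the $i$th smallest entry of each by $i$ yields the same word; a permutation contains $\sigma$ classically (resp. consecutively) if some subsequence (resp. consecutive subsequence) has the same relative order as $\sigma$, and avoids it otherwise. $\operatorname{SC}_{321}:S_n\to S_n$ sends a permutation through a stack: at each step, if there is a next input entry and placing it on top of the stack would make the stack contents, read top to bottom, avoid $321$ consecutively, push it; otherwise pop the top entry to the end of the output; stop when the output has length $n$. $\operatorname{Sort}_n(\operatorname{SC}_{321})$ is the set of $\pi\in S_n$ with $\operatorname{SC}_{321}(\pi)$ avoiding $231$ classically. Motzkin numbers: $M_0=M_1=1$ and $M_n=M_{n-1}+\sum_{i=0}^{n-2}M_iM_{n-2-i}$ for $n\ge2$. -}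

module Defs where

open import Data.Nat using (ℕ; zero; suc; _+_; _*_; _<ᵇ_)
open import Data.Bool using (Bool; true; false; _∧_; _∨_; not; if_then_else_)
open import Data.List using (List; []; _∷_; length; map; concatMap; filter; reverse; zipWith; upTo)
open import Data.Bool.ListAction using (any)
open import Data.Nat.ListAction using (sum)
open import Data.List.Relation.Unary.Unique.DecPropositional using (unique?)
open import Data.Nat.Properties using (_≟_)
open import Relation.Nullary.Decidable using (⌊_⌋)

-- Permutations of [n] in one-line notation are represented as lists of
-- naturals.

words : ℕ → ℕ → List (List ℕ)
words n zero    = [] ∷ []
words n (suc k) = concatMap (λ w → map (λ a → suc a ∷ w) (upTo n)) (words n k)

S : ℕ → List (List ℕ)
S n = filter (λ w → unique? _≟_ w) (words n n)

contains321consec : List ℕ → Bool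
contains321consec (a ∷ b ∷ c ∷ rest) =
  ((b <ᵇ a) ∧ (c <ᵇ b)) ∨ contains321consec (b ∷ c ∷ rest)
contains321consec _ = false

has31above : ℕ → List ℕ → Bool
has31above a []       = false
has31above a (b ∷ rest) =
  ((a <ᵇ b) ∧ any (λ c → c <ᵇ a) rest) ∨ has31above a rest

contains231 : List ℕ → Bool
contains231 []         = false
contains231 (a ∷ rest) = has31above a rest ∨ contains231 rest

avoids231 : List ℕ → Bool
avoids231 w = not (contains231 w)

-- State: remaining input, stack (head = top),
-- output so far (reversed).  The process stops when the output has
-- length n; since each entry is pushed once and popped once this takes
-- exactly 2n steps, which we supply as fuel (running out of both input and
-- stack also stops it).
scRun : ℕ → List ℕ → List ℕ → List ℕ → List ℕ
scRun zero       inp       stack       out = reverse out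
scRun (suc fuel) (x ∷ inp) stack       out with contains321consec (x ∷ stack)
... | false = scRun fuel inp (x ∷ stack) out
... | true  with stack
...   | []        = scRun fuel (x ∷ inp) [] out
...   | (t ∷ st)  = scRun fuel (x ∷ inp) st (t ∷ out)
scRun (suc fuel) []        (t ∷ st)    out = scRun fuel [] st (t ∷ out)
scRun (suc fuel) []        []          out = reverse out

SC321 : List ℕ → List ℕ
SC321 π = scRun (2 * length π) π [] []

Sort : ℕ → List (List ℕ)
Sort n = filter (λ π → avoids231 (SC321 π) Data.Bool.≟ true) (S n)

-- Motzkin numbers: M 0 = M 1 = 1, M n = M (n-1) + Σ_{i=0}^{n-2} M i M (n-2-i).
-- motzRev n = [M n, M (n-1), …, M 0]
motzRev : ℕ → List ℕ
motzRev zero          = 1 ∷ []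
motzRev (suc zero)    = 1 ∷ 1 ∷ []
motzRev (suc (suc n)) with motzRev (suc n)
... | prev = (headOr prev + sum (zipWith _*_ (reverse (dropOne prev)) (dropOne prev))) ∷ prev
  where
  headOr : List ℕ → ℕ
  headOr []      = 0
  headOr (x ∷ _) = x
  dropOne : List ℕ → List ℕ
  dropOne []       = []
  dropOne (_ ∷ xs) = xs

M : ℕ → ℕ
M n with motzRev n
... | []    = 0
... | x ∷ _ = x

-- If the reverse of π has no consecutive 321, every entry is pushed and then popped, so SC₃₂₁ π is the
-- reverse of π. Otherwise, at the first refused push the stack reads x > b > a from the top: b is popped,
-- x is pushed onto a and so output before it, and the output contains the 231 pattern b x a. Hence π is
-- sortable exactly when its reverse avoids 231 and consecutive 321.
--
-- By 231-avoidance such a permutation of [m+1] with first entry s is s, then a block on {1,…,s-1}, then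
-- a block on {s+1,…,m+1}, both blocks again of the same kind; no consecutive 321 at the start forces the
-- low block to be empty or to begin with 1, and removing that 1 leaves a permutation of size s-2. So the
-- counts satisfy M(m+1) = M(m) + Σ_{i<m} M(i) M(m-1-i), the Motzkin recurrence.

module Submission where

open import Defs
open import Data.Bool using (Bool; true; false; _∧_; _∨_; not; T)
open import Data.Bool.Properties using (∨-zeroʳ; ∨-identityʳ; ∧-zeroʳ; ∨-assoc; not-¬)
open import Data.Bool.ListAction using (any)
open import Data.List
  using (List; []; _∷_; length; map; reverse; _++_; _ʳ++_; [_]; upTo; downFrom; applyUpTo; filter; zipWith;
         concatMap; cartesianProductWith)
open import Data.List.Properties
  using (length-++; length-map; length-upTo; length-reverse; reverse-injective; reverse-involutive; reverse-map;
         reverse-upTo; map-∘; map-++; map-upTo; upTo-∷ʳ; map-injective; ∷-injectiveˡ; ∷-injectiveʳ)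
open import Data.List.Membership.Propositional using (_∈_)
open import Data.List.Membership.Propositional.Properties
  using (∈-∃++; ∈-++⁻; ∈-++⁺ˡ; ∈-++⁺ʳ; ∈-map⁺; ∈-map⁻; ∈-upTo⁺; ∈-upTo⁻; ∈-filter⁺; ∈-filter⁻;
         ∈-cartesianProductWith⁺; ∈-cartesianProductWith⁻)
open import Data.List.Relation.Binary.Permutation.Propositional using (_↭_; ↭-sym; ↭⇒↭ₛ)
open import Data.List.Relation.Binary.Permutation.Propositional.Properties using (↭-reverse; All-resp-↭)
open import Data.List.Relation.Binary.Permutation.Setoid.Properties using (Unique-resp-↭)
open import Data.List.Relation.Binary.Sublist.Propositional using (_⊆_; []; _∷_; _∷ʳ_; minimum)
open import Data.List.Relation.Binary.Sublist.Propositional.Properties using (Any-resp-⊆; ∷ˡ⁻)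
open import Data.List.Relation.Unary.All as All using (All; []; _∷_)
open import Data.List.Relation.Unary.All.Properties using (¬Any⇒All¬; map⁺; ++⁺; ++⁻ˡ; ++⁻ʳ)
open import Data.List.Relation.Unary.Any using (here; there)
open import Data.List.Relation.Unary.Unique.Propositional using (Unique; []; _∷_)
import Data.List.Relation.Unary.Unique.Propositional.Properties as Unique
open import Data.Nat using (ℕ; zero; suc; _+_; _*_; _∸_; _<ᵇ_; _≤_; _<_; z≤n; s≤s)
open import Data.Nat.Induction using (<-rec)
open import Data.Nat.ListAction using (sum)
open import Data.Nat.ListAction.Properties using (sum-++)
open import Data.Nat.Properties
open import Data.Nat.Tactic.RingSolver using (solve-∀)
open import Data.List.Membership.DecPropositional _≟_ using (_∈?_)
open import Data.Product using (∃; ∃₂; _×_; _,_; proj₁; proj₂; uncurry)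
open import Data.Sum using (_⊎_; inj₁; inj₂)
import Data.Sum as Sum
open import Data.Unit using (tt)
open import Function.Base using (_∘_; _$_)
open import Function.Bundles using (_⇔_; mk⇔; Equivalence)
open import Relation.Binary.Definitions using (tri<; tri≈; tri>)
open import Relation.Binary.PropositionalEquality hiding ([_])
open import Relation.Nullary using (¬_; yes; no; contradiction)
open import Relation.Unary using (Decidable)

∨≡false : ∀ {a b} → a ∨ b ≡ false → a ≡ false × b ≡ false
∨≡false {false} {false} refl = refl , refl

∧≡true : ∀ {a b} → a ∧ b ≡ true → a ≡ true × b ≡ true
∧≡true {true} {true} refl = refl , refl

∨≡true⇒ˡ : ∀ {a b} → a ∨ b ≡ true → b ≡ false → a ≡ true
∨≡true⇒ˡ {true}  _ _ = refl
∨≡true⇒ˡ {false} t f = contradiction f (not-¬ t)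

not≡true : ∀ {a} → not a ≡ true → a ≡ false
not≡true {false} refl = refl

<ᵇ-true⇒< : ∀ {m n} → (m <ᵇ n) ≡ true → m < n
<ᵇ-true⇒< {m} {n} eq = <ᵇ⇒< m n (subst T (sym eq) tt)

<⇒<ᵇ-true : ∀ {m n} → m < n → (m <ᵇ n) ≡ true
<⇒<ᵇ-true {m} {n} m<n with m <ᵇ n | <⇒<ᵇ m<n
... | true | _ = refl

<ᵇ-false⇒≥ : ∀ {m n} → (m <ᵇ n) ≡ false → n ≤ m
<ᵇ-false⇒≥ eq = ≮⇒≥ (λ m<n → subst T eq (<⇒<ᵇ m<n))

≥⇒<ᵇ-false : ∀ {m n} → n ≤ m → (m <ᵇ n) ≡ false
≥⇒<ᵇ-false {m} {n} n≤m with m <ᵇ n in eq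
... | false = refl
... | true  = contradiction (<ᵇ-true⇒< eq) (≤⇒≯ n≤m)

+-<ᵇ-+ : ∀ k a b → ((k + a) <ᵇ (k + b)) ≡ (a <ᵇ b)
+-<ᵇ-+ zero    a b = refl
+-<ᵇ-+ (suc k) a b = +-<ᵇ-+ k a b

AvoidsConsec321 : List ℕ → Set
AvoidsConsec321 w = contains321consec w ≡ false

Avoids231 : List ℕ → Set
Avoids231 w = contains231 w ≡ false

avoidsConsec321-∷⁻ : ∀ x w → AvoidsConsec321 (x ∷ w) → AvoidsConsec321 w
avoidsConsec321-∷⁻ x []          _ = refl
avoidsConsec321-∷⁻ x (b ∷ [])    _ = refl
avoidsConsec321-∷⁻ x (b ∷ c ∷ r) h = proj₂ (∨≡false h)

avoidsConsec321-++⁻ʳ : ∀ u {v} → AvoidsConsec321 (u ++ v) → AvoidsConsec321 v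
avoidsConsec321-++⁻ʳ []      h = h
avoidsConsec321-++⁻ʳ (x ∷ u) h = avoidsConsec321-++⁻ʳ u (avoidsConsec321-∷⁻ x (u ++ _) h)

avoidsConsec321-++⁻ˡ : ∀ u {v} → AvoidsConsec321 (u ++ v) → AvoidsConsec321 u
avoidsConsec321-++⁻ˡ []                    h = refl
avoidsConsec321-++⁻ˡ (x ∷ [])              h = refl
avoidsConsec321-++⁻ˡ (x ∷ y ∷ [])          h = refl
avoidsConsec321-++⁻ˡ (x ∷ u@(y ∷ z ∷ r))  h =
  cong₂ _∨_ (proj₁ (∨≡false h)) (avoidsConsec321-++⁻ˡ u (proj₂ (∨≡false h)))

contains321consec-head : ∀ {a b c} r → b < a → c < b → contains321consec (a ∷ b ∷ c ∷ r) ≡ true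
contains321consec-head r b<a c<b rewrite <⇒<ᵇ-true b<a | <⇒<ᵇ-true c<b = refl

avoidsConsec321-∷-below : ∀ {x q} ys → x ≤ q → All (q <_) ys →
                          AvoidsConsec321 ys → AvoidsConsec321 (x ∷ ys)
avoidsConsec321-∷-below []          _   _         _ = refl
avoidsConsec321-∷-below (y ∷ [])    _   _         _ = refl
avoidsConsec321-∷-below {x} (y ∷ z ∷ r) x≤q (q<y ∷ _) h
  rewrite ≥⇒<ᵇ-false {y} {x} (<⇒≤ (≤-<-trans x≤q q<y)) = h

-- A consecutive 321 cannot straddle the junction, since it would need a descent from xs into ys.
avoidsConsec321-++⁺ : ∀ q xs {ys} → All (_≤ q) xs → All (q <_) ys →
                      AvoidsConsec321 xs → AvoidsConsec321 ys → AvoidsConsec321 (xs ++ ys)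
avoidsConsec321-++⁺ q []                   _              _    _  hy = hy
avoidsConsec321-++⁺ q (x ∷ [])             (x≤q ∷ [])     ys>q _  hy = avoidsConsec321-∷-below _ x≤q ys>q hy
avoidsConsec321-++⁺ q (x ∷ y ∷ []) {[]}    _              _    _  _  = refl
avoidsConsec321-++⁺ q (x ∷ y ∷ []) {z ∷ r} (_ ∷ y≤q ∷ []) ys>q@(q<z ∷ _) _ hy =
  cong₂ _∨_ (trans (cong ((y <ᵇ x) ∧_) (≥⇒<ᵇ-false (<⇒≤ (≤-<-trans y≤q q<z)))) (∧-zeroʳ _))
            (avoidsConsec321-∷-below (z ∷ r) y≤q ys>q hy)
avoidsConsec321-++⁺ q (x ∷ xs@(y ∷ z ∷ r)) (_ ∷ xs≤q)     ys>q hx hy =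
  cong₂ _∨_ (proj₁ (∨≡false hx)) (avoidsConsec321-++⁺ q xs xs≤q ys>q (proj₂ (∨≡false hx)) hy)

avoidsConsec321-∷-min : ∀ a b w → All (b ≤_) w → AvoidsConsec321 (b ∷ w) → AvoidsConsec321 (a ∷ b ∷ w)
avoidsConsec321-∷-min a b []      _          h = refl
avoidsConsec321-∷-min a b (x ∷ r) (b≤x ∷ _) h
  rewrite ≥⇒<ᵇ-false {x} {b} b≤x | ∧-zeroʳ (b <ᵇ a) = h

contains321consec-map-+ : ∀ k w → contains321consec (map (k +_) w) ≡ contains321consec w
contains321consec-map-+ k []              = refl
contains321consec-map-+ k (x ∷ [])        = refl
contains321consec-map-+ k (x ∷ y ∷ [])    = refl
contains321consec-map-+ k (x ∷ y ∷ z ∷ r) =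
  cong₂ _∨_ (cong₂ _∧_ (+-<ᵇ-+ k y x) (+-<ᵇ-+ k z y)) (contains321consec-map-+ k (y ∷ z ∷ r))

any-++ : ∀ (p : ℕ → Bool) xs ys → any p (xs ++ ys) ≡ any p xs ∨ any p ys
any-++ p []       ys = refl
any-++ p (x ∷ xs) ys = trans (cong (p x ∨_) (any-++ p xs ys)) (sym (∨-assoc (p x) _ _))

any-∈ : ∀ (p : ℕ → Bool) {y w} → y ∈ w → p y ≡ true → any p w ≡ true
any-∈ p (here refl) py rewrite py = refl
any-∈ p {w = x ∷ _} (there y∈w) py rewrite any-∈ p y∈w py = ∨-zeroʳ (p x)

All≥⇒any<ᵇ-false : ∀ {a} w → All (a ≤_) w → any (_<ᵇ a) w ≡ false
All≥⇒any<ᵇ-false []      []          = refl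
All≥⇒any<ᵇ-false (x ∷ w) (a≤x ∷ a≤w) rewrite ≥⇒<ᵇ-false a≤x = All≥⇒any<ᵇ-false w a≤w

any<ᵇ-false⇒All≥ : ∀ {a} w → any (_<ᵇ a) w ≡ false → All (a ≤_) w
any<ᵇ-false⇒All≥ []      _ = []
any<ᵇ-false⇒All≥ (x ∷ w) h with x≮a , rest ← ∨≡false h = <ᵇ-false⇒≥ x≮a ∷ any<ᵇ-false⇒All≥ w rest

has31above-All≤ : ∀ {a} w → All (_≤ a) w → has31above a w ≡ false
has31above-All≤ []      []          = refl
has31above-All≤ (x ∷ w) (x≤a ∷ w≤a) rewrite ≥⇒<ᵇ-false x≤a = has31above-All≤ w w≤a

has31above-All≥ : ∀ {a} w → All (a ≤_) w → has31above a w ≡ false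
has31above-All≥ []      []          = refl
has31above-All≥ (x ∷ w) (_ ∷ a≤w)
  rewrite All≥⇒any<ᵇ-false w a≤w | has31above-All≥ w a≤w = trans (∨-identityʳ _) (∧-zeroʳ _)

has31above-++⁺ : ∀ {a} xs {ys} → has31above a xs ≡ false → All (a ≤_) ys → has31above a (xs ++ ys) ≡ false
has31above-++⁺ []           _ a≤ys = has31above-All≥ _ a≤ys
has31above-++⁺ {a} (b ∷ xs) {ys} h a≤ys
  rewrite any-++ (_<ᵇ a) xs ys | All≥⇒any<ᵇ-false ys a≤ys | ∨-identityʳ (any (_<ᵇ a) xs)
        | has31above-++⁺ xs (proj₂ (∨≡false h)) a≤ys = trans (∨-identityʳ _) (proj₁ (∨≡false h))

has31above-++⁻ˡ : ∀ {a} xs {ys} → has31above a (xs ++ ys) ≡ false → has31above a xs ≡ false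
has31above-++⁻ˡ []           _ = refl
has31above-++⁻ˡ {a} (b ∷ xs) {ys} h with a <ᵇ b
... | false = has31above-++⁻ˡ xs h
... | true  rewrite any-++ (_<ᵇ a) xs ys with ∨≡false h
...   | h₁ , h₂ = cong₂ _∨_ (proj₁ (∨≡false h₁)) (has31above-++⁻ˡ xs h₂)

has31above-sublist : ∀ {x a b r} Z → (x ∷ a ∷ r) ⊆ Z → b < x → a < b → has31above b Z ≡ true
has31above-sublist (y ∷ Z) (.y ∷ʳ s) b<x a<b rewrite has31above-sublist Z s b<x a<b = ∨-zeroʳ _
has31above-sublist {b = b} (x ∷ Z) (refl ∷ s) b<x a<b
  rewrite <⇒<ᵇ-true b<x | any-∈ (_<ᵇ b) (Any-resp-⊆ s (here refl)) (<⇒<ᵇ-true a<b) = refl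

contains231-head : ∀ {a b c} r → b < c → a < b → a ∈ r → contains231 (b ∷ c ∷ r) ≡ true
contains231-head {b = b} r b<c a<b a∈r
  rewrite <⇒<ᵇ-true b<c | any-∈ (_<ᵇ b) a∈r (<⇒<ᵇ-true a<b) = refl

avoids231-++⁻ˡ : ∀ xs {ys} → Avoids231 (xs ++ ys) → Avoids231 xs
avoids231-++⁻ˡ []       _ = refl
avoids231-++⁻ˡ (x ∷ xs) h with h₁ , h₂ ← ∨≡false h = cong₂ _∨_ (has31above-++⁻ˡ xs h₁) (avoids231-++⁻ˡ xs h₂)

avoids231-++⁻ʳ : ∀ xs {ys} → Avoids231 (xs ++ ys) → Avoids231 ys
avoids231-++⁻ʳ []       h = h
avoids231-++⁻ʳ (x ∷ xs) h = avoids231-++⁻ʳ xs (proj₂ (∨≡false h))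

avoids231-++⁺ : ∀ q xs {ys} → All (_< q) xs → All (q <_) ys →
                Avoids231 xs → Avoids231 ys → Avoids231 (xs ++ ys)
avoids231-++⁺ q []       _            _    _  hy = hy
avoids231-++⁺ q (x ∷ xs) (x<q ∷ xs<q) ys>q hx hy =
  cong₂ _∨_ (has31above-++⁺ xs (proj₁ (∨≡false hx)) (All.map (λ q<y → <⇒≤ (<-trans x<q q<y)) ys>q))
            (avoids231-++⁺ q xs xs<q ys>q (proj₂ (∨≡false hx)) hy)

any-map-+ : ∀ k a w → any (_<ᵇ (k + a)) (map (k +_) w) ≡ any (_<ᵇ a) w
any-map-+ k a []      = refl
any-map-+ k a (x ∷ w) = cong₂ _∨_ (+-<ᵇ-+ k x a) (any-map-+ k a w)

has31above-map-+ : ∀ k a w → has31above (k + a) (map (k +_) w) ≡ has31above a w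
has31above-map-+ k a []      = refl
has31above-map-+ k a (b ∷ w) =
  cong₂ _∨_ (cong₂ _∧_ (+-<ᵇ-+ k a b) (any-map-+ k a w)) (has31above-map-+ k a w)

contains231-map-+ : ∀ k w → contains231 (map (k +_) w) ≡ contains231 w
contains231-map-+ k []      = refl
contains231-map-+ k (a ∷ w) = cong₂ _∨_ (has31above-map-+ k a w) (contains231-map-+ k w)

avoidsConsec321-ʳ++⁻ʳ : ∀ u {v} → AvoidsConsec321 (u ʳ++ v) → AvoidsConsec321 v
avoidsConsec321-ʳ++⁻ʳ []      h = h
avoidsConsec321-ʳ++⁻ʳ (x ∷ u) {v} h = avoidsConsec321-∷⁻ x v (avoidsConsec321-ʳ++⁻ʳ u h)

contains231-ʳ++⁺ : ∀ u {v} → contains231 v ≡ true → contains231 (u ʳ++ v) ≡ true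
contains231-ʳ++⁺ []      h = h
contains231-ʳ++⁺ (x ∷ u) {v} h = contains231-ʳ++⁺ u (trans (cong (has31above x v ∨_) h) (∨-zeroʳ _))

-- The stack sorting map

fuel-push : ∀ n s {f} → 2 * suc n + s ≤ suc f → 2 * n + suc s ≤ f
fuel-push n s {f} p = ≤-pred (subst (_≤ suc f) (identity n s) p)
  where
  identity : ∀ n s → 2 * suc n + s ≡ suc (2 * n + suc s)
  identity = solve-∀

fuel-pop : ∀ n s {f} → 2 * n + suc s ≤ suc f → 2 * n + s ≤ f
fuel-pop n s {f} p = ≤-pred (subst (_≤ suc f) (+-suc (2 * n) s) p)

scRun-pushAll : ∀ inp st out g → AvoidsConsec321 (inp ʳ++ st) →
                scRun (length inp + g) inp st out ≡ scRun g [] (inp ʳ++ st) out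
scRun-pushAll []        st out g _ = refl
scRun-pushAll (x ∷ inp) st out g h
  rewrite avoidsConsec321-ʳ++⁻ʳ inp h = scRun-pushAll inp (x ∷ st) out g h

scRun-popAll : ∀ st out g → scRun (length st + g) [] st out ≡ out ʳ++ st
scRun-popAll []       out zero    = refl
scRun-popAll []       out (suc g) = refl
scRun-popAll (t ∷ st) out g       = scRun-popAll st (t ∷ out) g

scRun-outputsStack : ∀ fuel inp st out → 2 * length inp + length st ≤ fuel →
                     ∃ λ Z → scRun fuel inp st out ≡ out ʳ++ Z × st ⊆ Z
scRun-outputsStack zero    []        []       out z≤n = [] , refl , []
scRun-outputsStack (suc f) []        []       out _   = [] , refl , []
scRun-outputsStack (suc f) []        (t ∷ st) out p
  with Z , run , st⊆Z ← scRun-outputsStack f [] st (t ∷ out) (fuel-pop 0 (length st) p) =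
  t ∷ Z , run , refl ∷ st⊆Z
scRun-outputsStack (suc f) (x ∷ inp) []       out p
  with Z , run , _ ← scRun-outputsStack f inp (x ∷ []) out (fuel-push (length inp) 0 p) =
  Z , run , minimum Z
scRun-outputsStack (suc f) (x ∷ inp) (t ∷ st) out p with contains321consec (x ∷ t ∷ st)
... | false
  with Z , run , x∷t∷st⊆Z ← scRun-outputsStack f inp (x ∷ t ∷ st) out
                               (fuel-push (length inp) (suc (length st)) p) =
  Z , run , ∷ˡ⁻ x∷t∷st⊆Z
... | true
  with Z , run , st⊆Z ← scRun-outputsStack f (x ∷ inp) st (t ∷ out)
                           (fuel-pop (suc (length inp)) (length st) p) =
  t ∷ Z , run , refl ∷ st⊆Z

avoidsConsec321-∷-replace : ∀ {a b} x r → a < b → AvoidsConsec321 (b ∷ a ∷ r) → AvoidsConsec321 (x ∷ a ∷ r)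
avoidsConsec321-∷-replace x []      _   _ = refl
avoidsConsec321-∷-replace {a} x (c ∷ r) a<b h =
  cong₂ _∨_ (trans (cong ((a <ᵇ x) ∧_) c≮a) (∧-zeroʳ _)) (proj₂ (∨≡false h))
  where
  c≮a : (c <ᵇ a) ≡ false
  c≮a = trans (sym (cong (_∧ (c <ᵇ a)) (<⇒<ᵇ-true a<b))) (proj₁ (∨≡false h))

scRun-push : ∀ f x inp st out → AvoidsConsec321 (x ∷ st) →
             scRun (suc f) (x ∷ inp) st out ≡ scRun f inp (x ∷ st) out
scRun-push f x inp []       out _ = refl
scRun-push f x inp (t ∷ st) out h rewrite h = refl

scRun-contains231 : ∀ fuel inp st out → 2 * length inp + length st ≤ fuel →
                    AvoidsConsec321 st → contains321consec (inp ʳ++ st) ≡ true →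
                    contains231 (scRun fuel inp st out) ≡ true
scRun-contains231 fuel    []        st          out _ h t = contradiction h (not-¬ t)
scRun-contains231 (suc f) (x ∷ inp) []          out p _ t =
  scRun-contains231 f inp (x ∷ []) out (fuel-push (length inp) 0 p) refl t
scRun-contains231 (suc f) (x ∷ inp) (b ∷ [])    out p _ t =
  scRun-contains231 f inp (x ∷ b ∷ []) out (fuel-push (length inp) 1 p) refl t
scRun-contains231 (suc f) (x ∷ inp) (b ∷ a ∷ r) out p h t with contains321consec (x ∷ b ∷ a ∷ r) in e
... | false = scRun-contains231 f inp (x ∷ b ∷ a ∷ r) out (fuel-push (length inp) (2 + length r) p) e t
... | true  = afterPop f (fuel-pop (suc (length inp)) (suc (length r)) p)
  where
  b<ᵇx×a<ᵇb : (b <ᵇ x) ≡ true × (a <ᵇ b) ≡ true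
  b<ᵇx×a<ᵇb = ∧≡true (∨≡true⇒ˡ e h)
  b<x : b < x
  b<x = <ᵇ-true⇒< (proj₁ b<ᵇx×a<ᵇb)
  a<b : a < b
  a<b = <ᵇ-true⇒< (proj₂ b<ᵇx×a<ᵇb)

  afterPop : ∀ f → 2 * length (x ∷ inp) + length (a ∷ r) ≤ f →
             contains231 (scRun f (x ∷ inp) (a ∷ r) (b ∷ out)) ≡ true
  afterPop (suc f) q
    rewrite scRun-push f x inp (a ∷ r) (b ∷ out) (avoidsConsec321-∷-replace x r a<b h)
    with Z , run , x∷a∷r⊆Z ← scRun-outputsStack f inp (x ∷ a ∷ r) (b ∷ out)
                                 (fuel-push (length inp) (suc (length r)) q)
    rewrite run =
    contains231-ʳ++⁺ out (cong (_∨ contains231 Z) (has31above-sublist Z x∷a∷r⊆Z b<x a<b))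

Avoiding : List ℕ → Set
Avoiding w = Avoids231 w × AvoidsConsec321 w

SC321-reverse : ∀ π → AvoidsConsec321 (reverse π) → SC321 π ≡ reverse π
-- The first step uses that 2 * n unfolds to n + (n + 0).
SC321-reverse π h = begin
  scRun (2 * length π) π [] []                      ≡⟨ scRun-pushAll π [] [] (length π + 0) h ⟩
  scRun (length π + 0) [] (reverse π) []            ≡⟨ cong (λ n → scRun (n + 0) [] (reverse π) []) |π|≡ ⟩
  scRun (length (reverse π) + 0) [] (reverse π) []  ≡⟨ scRun-popAll (reverse π) [] 0 ⟩
  reverse π                                         ∎
  where
  open ≡-Reasoning
  |π|≡ : length π ≡ length (reverse π)
  |π|≡ = sym (length-reverse π)

SC321-contains231 : ∀ π → contains321consec (reverse π) ≡ true → contains231 (SC321 π) ≡ true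
SC321-contains231 π = scRun-contains231 (2 * length π) π [] [] (≤-reflexive (+-identityʳ (2 * length π))) refl

sortable⇔avoiding-reverse : ∀ π → (avoids231 (SC321 π) ≡ true) ⇔ Avoiding (reverse π)
sortable⇔avoiding-reverse π = mk⇔ to from
  where
  to : avoids231 (SC321 π) ≡ true → Avoiding (reverse π)
  to sortable with contains321consec (reverse π) in e
  ... | true  = contradiction (not≡true sortable) (not-¬ (SC321-contains231 π e))
  ... | false = trans (cong contains231 (sym (SC321-reverse π e))) (not≡true sortable) , refl

  from : Avoiding (reverse π) → avoids231 (SC321 π) ≡ true
  from (h231 , h321) rewrite SC321-reverse π h321 | h231 = refl

Unique⇒length≤ : ∀ {A : Set} {xs ys : List A} → Unique xs → (∀ {z} → z ∈ xs → z ∈ ys) →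
                 length xs ≤ length ys
Unique⇒length≤ {xs = []}     _            _    = z≤n
Unique⇒length≤ {xs = x ∷ xs} (x∉xs ∷ uxs) xs⊆ys with u , v , refl ← ∈-∃++ (xs⊆ys (here refl)) = begin
  suc (length xs)            ≤⟨ s≤s (Unique⇒length≤ uxs xs⊆u++v) ⟩
  suc (length (u ++ v))      ≡⟨ cong suc (length-++ u) ⟩
  suc (length u + length v)  ≡⟨ sym (+-suc (length u) (length v)) ⟩
  length u + suc (length v)  ≡⟨ sym (length-++ u) ⟩
  length (u ++ x ∷ v)        ∎
  where
  open ≤-Reasoning
  xs⊆u++v : ∀ {z} → z ∈ xs → z ∈ u ++ v
  xs⊆u++v z∈xs with ∈-++⁻ u (xs⊆ys (there z∈xs))
  ... | inj₁ z∈u         = ∈-++⁺ˡ z∈u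
  ... | inj₂ (here refl) = contradiction refl (All.lookup x∉xs z∈xs)
  ... | inj₂ (there z∈v) = ∈-++⁺ʳ u z∈v

InRange : ℕ → ℕ → Set
InRange n x = 1 ≤ x × x ≤ n

record IsPerm (n : ℕ) (w : List ℕ) : Set where
  constructor isPerm
  field
    length≡  : length w ≡ n
    inRange  : All (InRange n) w
    distinct : Unique w

open IsPerm

AvPerm : ℕ → List ℕ → Set
AvPerm n w = IsPerm n w × Avoiding w

unique∧inRange⇒length≤ : ∀ {n w} → Unique w → All (InRange n) w → length w ≤ n
unique∧inRange⇒length≤ {n} {w} u r = begin
  length w                     ≤⟨ Unique⇒length≤ u (λ x∈w → range∋ (All.lookup r x∈w)) ⟩
  length (map suc (upTo n))    ≡⟨ trans (length-map suc (upTo n)) (length-upTo n) ⟩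
  n                            ∎
  where
  open ≤-Reasoning
  range∋ : ∀ {x} → InRange n x → x ∈ map suc (upTo n)
  range∋ {suc x} (_ , x<n) = ∈-map⁺ suc (∈-upTo⁺ x<n)

isPerm⇒∈ : ∀ {n w x} → IsPerm n w → InRange n x → x ∈ w
isPerm⇒∈ {n} {w} {x} p x∈range with x ∈? w
... | yes x∈w = x∈w
... | no  x∉w = contradiction (subst (λ k → suc k ≤ n) (length≡ p) longer) 1+n≰n
  where
  longer : length (x ∷ w) ≤ n
  longer = unique∧inRange⇒length≤ (¬Any⇒All¬ w x∉w ∷ distinct p) (x∈range ∷ inRange p)

isPerm-reverse : ∀ {n w} → IsPerm n w → IsPerm n (reverse w)
isPerm-reverse {w = w} (isPerm len range uniq) =
  isPerm (trans (length-reverse w) len) (All-resp-↭ reverse↭ range)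
         (Unique-resp-↭ (setoid ℕ) (↭⇒↭ₛ reverse↭) uniq)
  where
  reverse↭ : w ↭ reverse w
  reverse↭ = ↭-sym (↭-reverse w)

-- Decomposition at the first entry

+-pinched : ∀ {a b c d} → a ≤ c → b ≤ d → a + b ≡ c + d → a ≡ c × b ≡ d
+-pinched {a} {b} {c} {d} a≤c b≤d eq = a≡c , +-cancelˡ-≡ a b d (trans eq (cong (_+ d) (sym a≡c)))
  where
  a≡c : a ≡ c
  a≡c = ≤-antisym a≤c (+-cancelʳ-≤ d c a (≤-trans (≤-reflexive (sym eq)) (+-monoʳ-≤ a b≤d)))

unique-++⁻ˡ : ∀ {A : Set} xs {ys : List A} → Unique (xs ++ ys) → Unique xs
unique-++⁻ˡ []       _            = []
unique-++⁻ˡ (x ∷ xs) (x∉ ∷ uniq) = ++⁻ˡ xs x∉ ∷ unique-++⁻ˡ xs uniq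

unique-++⁻ʳ : ∀ {A : Set} xs {ys : List A} → Unique (xs ++ ys) → Unique ys
unique-++⁻ʳ []       uniq       = uniq
unique-++⁻ʳ (x ∷ xs) (_ ∷ uniq) = unique-++⁻ʳ xs uniq

map-+-∸ : ∀ k w → All (k ≤_) w → map (k +_) (map (_∸ k) w) ≡ w
map-+-∸ k []      []          = refl
map-+-∸ k (x ∷ w) (k≤x ∷ k≤w) = cong₂ _∷_ (m+[n∸m]≡n k≤x) (map-+-∸ k w k≤w)

-- The entries of τ smaller than s must all precede those larger than s, or s would start a 231.
has31above-split : ∀ s τ → has31above s τ ≡ false → All (s ≢_) τ →
                   ∃₂ λ τ₁ τ₂ → τ ≡ τ₁ ++ τ₂ × All (_< s) τ₁ × All (s <_) τ₂
has31above-split s []      _ _               = [] , [] , refl , [] , []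
has31above-split s (b ∷ τ) h (s≢b ∷ s∉τ) with <-cmp b s
... | tri< b<s _ _ with τ₁ , τ₂ , refl , τ₁<s , s<τ₂ ← has31above-split s τ (proj₂ (∨≡false h)) s∉τ =
  b ∷ τ₁ , τ₂ , refl , b<s ∷ τ₁<s , s<τ₂
... | tri≈ _ b≡s _ = contradiction (sym b≡s) s≢b
... | tri> _ _ s<b = [] , b ∷ τ , refl , [] , s<b ∷ All.zipWith (uncurry ≤∧≢⇒<) (s≤τ , s∉τ)
  where
  s≤τ : All (s ≤_) τ
  s≤τ = any<ᵇ-false⇒All≥ τ (trans (sym (cong (_∧ any (_<ᵇ s) τ) (<⇒<ᵇ-true s<b))) (proj₁ (∨≡false h)))

disassemble : ∀ {m s τ} → AvPerm (suc m) (suc s ∷ τ) →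
              s ≤ m × ∃₂ λ τ₁ τ₂ → AvPerm s τ₁ × AvPerm (m ∸ s) τ₂ × τ ≡ τ₁ ++ map (suc s +_) τ₂
disassemble {m} {s} (isPerm len ((_ , s<m) ∷ range) (s∉τ ∷ uniq) , h231 , h321)
  with τ₁ , τ₂ , refl , τ₁<s , s<τ₂ ← has31above-split (suc s) _ (proj₁ (∨≡false h231)) s∉τ =
  s≤m , τ₁ , τ₂′ ,
  (isPerm (proj₁ lengths) range₁ uniq₁ , avoids₁) ,
  (isPerm (proj₂ lengths) range₂ uniq₂ , avoids₂) ,
  cong (τ₁ ++_) (sym shift)
  where
  s≤m : s ≤ m
  s≤m = ≤-pred s<m
  τ₂′ : List ℕ
  τ₂′ = map (_∸ suc s) τ₂
  shift : map (suc s +_) τ₂′ ≡ τ₂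
  shift = map-+-∸ (suc s) τ₂ (All.map <⇒≤ s<τ₂)

  range₁ : All (InRange s) τ₁
  range₁ = All.zipWith (λ ((1≤x , _) , x<s) → 1≤x , ≤-pred x<s) (++⁻ˡ τ₁ range , τ₁<s)
  range₂ : All (InRange (m ∸ s)) τ₂′
  range₂ = map⁺ (All.zipWith (λ ((_ , x≤m) , s<x) → m<n⇒0<n∸m s<x , ∸-monoˡ-≤ (suc s) x≤m)
                              (++⁻ʳ τ₁ range , s<τ₂))

  uniq₁ : Unique τ₁
  uniq₁ = unique-++⁻ˡ τ₁ uniq
  uniq₂ : Unique τ₂′
  uniq₂ = Unique.map⁻ (subst Unique (sym shift) (unique-++⁻ʳ τ₁ uniq))

  h231′ : Avoids231 (τ₁ ++ τ₂)
  h231′ = proj₂ (∨≡false h231)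
  h321′ : AvoidsConsec321 (τ₁ ++ τ₂)
  h321′ = avoidsConsec321-∷⁻ (suc s) (τ₁ ++ τ₂) h321
  avoids₁ : Avoiding τ₁
  avoids₁ = avoids231-++⁻ˡ τ₁ h231′ , avoidsConsec321-++⁻ˡ τ₁ h321′
  avoids₂ : Avoiding τ₂′
  avoids₂ = trans (sym (contains231-map-+ (suc s) τ₂′))
                  (trans (cong contains231 shift) (avoids231-++⁻ʳ τ₁ h231′)) ,
            trans (sym (contains321consec-map-+ (suc s) τ₂′))
                  (trans (cong contains321consec shift) (avoidsConsec321-++⁻ʳ τ₁ h321′))

  total : length τ₁ + length τ₂′ ≡ s + (m ∸ s)
  total = begin
    length τ₁ + length τ₂′  ≡⟨ cong (length τ₁ +_) (length-map (_∸ suc s) τ₂) ⟩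
    length τ₁ + length τ₂   ≡⟨ sym (length-++ τ₁) ⟩
    length (τ₁ ++ τ₂)       ≡⟨ suc-injective len ⟩
    m                       ≡⟨ sym (m+[n∸m]≡n s≤m) ⟩
    s + (m ∸ s)             ∎
    where open ≡-Reasoning
  lengths : length τ₁ ≡ s × length τ₂′ ≡ m ∸ s
  lengths = +-pinched (unique∧inRange⇒length≤ uniq₁ range₁) (unique∧inRange⇒length≤ uniq₂ range₂) total

assemble : ℕ → List ℕ → List ℕ → List ℕ
assemble s τ₁ τ₂ = suc s ∷ τ₁ ++ map (suc s +_) τ₂

assemble-avPerm : ∀ {m s τ₁ τ₂} → s ≤ m → AvPerm s τ₁ → AvPerm (m ∸ s) τ₂ → AvoidsConsec321 (suc s ∷ τ₁) →
                  AvPerm (suc m) (assemble s τ₁ τ₂)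
assemble-avPerm {m} {s} {τ₁} {τ₂} s≤m (isPerm len₁ range₁ uniq₁ , h231₁ , _)
                                      (isPerm len₂ range₂ uniq₂ , h231₂ , h321₂) h321₁ =
  isPerm len range (s∉ ∷ Unique.++⁺ uniq₁ uniqB disjoint) ,
  cong₂ _∨_ (has31above-++⁺ τ₁ (has31above-All≤ τ₁ (All.map <⇒≤ τ₁<s)) (All.map <⇒≤ s<B))
            (avoids231-++⁺ (suc s) τ₁ τ₁<s s<B h231₁ (trans (contains231-map-+ (suc s) τ₂) h231₂)) ,
  avoidsConsec321-++⁺ (suc s) (suc s ∷ τ₁) (≤-refl ∷ All.map <⇒≤ τ₁<s) s<B h321₁
                      (trans (contains321consec-map-+ (suc s) τ₂) h321₂)
  where
  B : List ℕ
  B = map (suc s +_) τ₂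
  τ₁<s : All (_< suc s) τ₁
  τ₁<s = All.map (s≤s ∘ proj₂) range₁
  s<B : All (suc s <_) B
  s<B = map⁺ (All.map (m<m+n (suc s) ∘ proj₁) range₂)

  len : length (assemble s τ₁ τ₂) ≡ suc m
  len = cong suc (begin
    length (τ₁ ++ B)          ≡⟨ length-++ τ₁ ⟩
    length τ₁ + length B      ≡⟨ cong₂ _+_ len₁ (trans (length-map (suc s +_) τ₂) len₂) ⟩
    s + (m ∸ s)               ≡⟨ m+[n∸m]≡n s≤m ⟩
    m                         ∎)
    where open ≡-Reasoning
  range : All (InRange (suc m)) (assemble s τ₁ τ₂)
  range = (s≤s z≤n , s≤s s≤m) ∷
    ++⁺ (All.map (λ (1≤x , x≤s) → 1≤x , m≤n⇒m≤1+n (≤-trans x≤s s≤m)) range₁)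
        (map⁺ (All.map (λ (_ , y≤m∸s) → s≤s z≤n , s≤s (≤-trans (+-monoʳ-≤ s y≤m∸s) s+[m∸s]≤m)) range₂))
    where
    s+[m∸s]≤m : s + (m ∸ s) ≤ m
    s+[m∸s]≤m = ≤-reflexive (m+[n∸m]≡n s≤m)

  s∉ : All (suc s ≢_) (τ₁ ++ B)
  s∉ = ++⁺ (All.map (λ x<s s≡x → <-irrefl (sym s≡x) x<s) τ₁<s) (All.map <⇒≢ s<B)
  uniqB : Unique B
  uniqB = Unique.map⁺ (+-cancelˡ-≡ (suc s) _ _) uniq₂
  disjoint : ∀ {x} → ¬ (x ∈ τ₁ × x ∈ B)
  disjoint (x∈τ₁ , x∈B) = <-asym (All.lookup τ₁<s x∈τ₁) (All.lookup s<B x∈B)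

oneFirst : List ℕ → List ℕ
oneFirst τ = assemble 0 [] τ

peakFirst : ℕ → List ℕ → List ℕ → List ℕ
peakFirst i ρ τ = assemble (suc i) (oneFirst ρ) τ

avPerm-[] : AvPerm 0 []
avPerm-[] = isPerm refl [] [] , refl , refl

avPerm-0⇒[] : ∀ {τ} → AvPerm 0 τ → τ ≡ []
avPerm-0⇒[] {[]}    _                   = refl
avPerm-0⇒[] {_ ∷ _} (isPerm () _ _ , _)

oneFirst-avPerm : ∀ {m τ} → AvPerm m τ → AvPerm (suc m) (oneFirst τ)
oneFirst-avPerm av = assemble-avPerm z≤n avPerm-[] av refl

peakFirst-avPerm : ∀ {m i ρ τ} → i < m → AvPerm i ρ → AvPerm (m ∸ suc i) τ → AvPerm (suc m) (peakFirst i ρ τ)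
peakFirst-avPerm {i = i} {ρ} i<m avρ avτ =
  assemble-avPerm i<m avOne avτ (avoidsConsec321-∷-min (suc (suc i)) 1 (map suc ρ) 1≤ρ (proj₂ (proj₂ avOne)))
  where
  avOne : AvPerm (suc i) (oneFirst ρ)
  avOne = oneFirst-avPerm avρ
  1≤ρ : All (1 ≤_) (map suc ρ)
  1≤ρ = map⁺ (All.tabulate (λ _ → s≤s z≤n))

-- The entry c after b exceeds b, or s b c is a consecutive 321; an entry below b after c completes a 231.
noSmallerAfter : ∀ {s b a} ρ → b < s → AvoidsConsec321 (s ∷ b ∷ ρ) → Avoids231 (b ∷ ρ) → All (b ≢_) ρ →
                 a ∈ ρ → b ≤ a
noSmallerAfter {b = b} (c ∷ ρ) b<s h321 h231 (b≢c ∷ _) a∈ with <-cmp c b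
... | tri< c<b _ _ = contradiction h321 (not-¬ (contains321consec-head ρ b<s c<b))
... | tri≈ _ c≡b _ = contradiction (sym c≡b) b≢c
... | tri> _ _ b<c with a∈
...   | here refl = <⇒≤ b<c
...   | there a∈ρ = ≮⇒≥ (λ a<b → contradiction h231 (not-¬ (contains231-head ρ b<c a<b a∈ρ)))

avPerm-head≡1 : ∀ {i s b ρ} → AvPerm (suc i) (b ∷ ρ) → b < s → AvoidsConsec321 (s ∷ b ∷ ρ) → b ≡ 1
avPerm-head≡1 (p@(isPerm _ ((1≤b , _) ∷ _) (b∉ρ ∷ _)) , h231 , _) b<s h321
  with isPerm⇒∈ p (≤-refl , s≤s z≤n)
... | here 1≡b  = sym 1≡b
... | there 1∈ρ = ≤-antisym (noSmallerAfter _ b<s h321 h231 b∉ρ 1∈ρ) 1≤b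

OneFirst : ℕ → List ℕ → Set
OneFirst m z = ∃ λ τ → AvPerm m τ × z ≡ oneFirst τ

PeakFirstAt : ℕ → ℕ → List ℕ → Set
PeakFirstAt m i z = ∃₂ λ ρ τ → AvPerm i ρ × AvPerm (m ∸ suc i) τ × z ≡ peakFirst i ρ τ

PeakFirst : ℕ → ℕ → List ℕ → Set
PeakFirst m l z = ∃ λ i → i < l × PeakFirstAt m i z

decompose : ∀ {m w} → AvPerm (suc m) w → OneFirst m w ⊎ PeakFirst m m w
decompose {w = []}    (isPerm () _ _ , _)
decompose {w = 0 ∷ _} (isPerm _ ((() , _) ∷ _) _ , _)
decompose {w = 1 ∷ _} av with disassemble av
... | _ , τ₁ , τ₂ , av₁ , av₂ , refl with refl ← avPerm-0⇒[] av₁ = inj₁ (τ₂ , av₂ , refl)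
decompose {w = suc (suc i) ∷ _} av@(_ , _ , h321) with disassemble av
... | _   , []    , _  , (isPerm () _ _ , _) , _ , _
... | i<m , b ∷ ρ , τ , av₁@(isPerm _ ((_ , b≤1+i) ∷ _) _ , _) , avτ , refl
  with refl ← avPerm-head≡1 av₁ (s≤s b≤1+i) (avoidsConsec321-++⁻ˡ (suc (suc i) ∷ b ∷ ρ) h321)
  with _ , _ , ρ′ , av₀ , avρ′ , refl ← disassemble av₁
  with refl ← avPerm-0⇒[] av₀ = inj₂ (i , i<m , ρ′ , τ , avρ′ , avτ , refl)

compose : ∀ {m w} → OneFirst m w ⊎ PeakFirst m m w → AvPerm (suc m) w
compose (inj₁ (τ , avτ , refl))                   = oneFirst-avPerm avτ
compose (inj₂ (i , i<m , ρ , τ , avρ , avτ , refl)) = peakFirst-avPerm i<m avρ avτ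

record Enumerates {A : Set} (P : A → Set) (xs : List A) : Set where
  field
    unique   : Unique xs
    sound    : ∀ {z} → z ∈ xs → P z
    complete : ∀ {z} → P z → z ∈ xs

open Enumerates

module _ {A : Set} where

  enumerates-length : ∀ {P : A → Set} {xs ys} → Enumerates P xs → Enumerates P ys → length xs ≡ length ys
  enumerates-length e f = ≤-antisym (Unique⇒length≤ (unique e) (complete f ∘ sound e))
                                    (Unique⇒length≤ (unique f) (complete e ∘ sound f))

  enumerates-resp : ∀ {P Q : A → Set} {xs} → (∀ {z} → P z → Q z) → (∀ {z} → Q z → P z) →
                    Enumerates P xs → Enumerates Q xs
  enumerates-resp P⇒Q Q⇒P e = record
    { unique = unique e ; sound = P⇒Q ∘ sound e ; complete = complete e ∘ Q⇒P }

  enumerates-++ : ∀ {P Q : A → Set} {xs ys} → (∀ {z} → P z → ¬ Q z) →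
                  Enumerates P xs → Enumerates Q ys → Enumerates (λ z → P z ⊎ Q z) (xs ++ ys)
  enumerates-++ {xs = xs} disjoint e f = record
    { unique   = Unique.++⁺ (unique e) (unique f) (λ (z∈xs , z∈ys) → disjoint (sound e z∈xs) (sound f z∈ys))
    ; sound    = Sum.map (sound e) (sound f) ∘ ∈-++⁻ xs
    ; complete = Sum.[ ∈-++⁺ˡ ∘ complete e , ∈-++⁺ʳ xs ∘ complete f ]
    }

  enumerates-filter : ∀ {P Q : A → Set} {xs} (Q? : Decidable Q) →
                      Enumerates P xs → Enumerates (λ z → P z × Q z) (filter Q? xs)
  enumerates-filter Q? e = record
    { unique   = Unique.filter⁺ Q? (unique e)
    ; sound    = λ z∈ → let z∈xs , qz = ∈-filter⁻ Q? z∈ in sound e z∈xs , qz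
    ; complete = λ (pz , qz) → ∈-filter⁺ Q? (complete e pz) qz
    }

module _ {A B : Set} {P : A → Set} (f : A → B) (inj : ∀ {a b} → P a → P b → f a ≡ f b → a ≡ b) where

  unique-map⁺ : ∀ {xs} → All P xs → Unique xs → Unique (map f xs)
  unique-map⁺ []         []           = []
  unique-map⁺ (px ∷ pxs) (x∉xs ∷ uxs) =
    map⁺ (All.zipWith (λ (py , x≢y) fx≡fy → x≢y (inj px py fx≡fy)) (pxs , x∉xs)) ∷ unique-map⁺ pxs uxs

  enumerates-map : ∀ {xs} → Enumerates P xs → Enumerates (λ z → ∃ λ x → P x × z ≡ f x) (map f xs)
  enumerates-map e = record
    { unique   = unique-map⁺ (All.tabulate (sound e)) (unique e)
    ; sound    = λ z∈ → let x , x∈xs , z≡fx = ∈-map⁻ f z∈ in x , sound e x∈xs , z≡fx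
    ; complete = λ { (x , px , refl) → ∈-map⁺ f (complete e px) }
    }

module _ {A B C : Set} {P : A → Set} {Q : B → Set} (g : A → B → C)
         (inj : ∀ {x x′ y y′} → P x → P x′ → Q y → Q y′ → g x y ≡ g x′ y′ → x ≡ x′ × y ≡ y′) where

  unique-cartesianProductWith⁺ : ∀ {xs ys} → All P xs → All Q ys → Unique xs → Unique ys →
                                 Unique (cartesianProductWith g xs ys)
  unique-cartesianProductWith⁺ []         _   []           _   = []
  unique-cartesianProductWith⁺ {x ∷ xs} {ys} (px ∷ pxs) qys (x∉xs ∷ uxs) uys =
    Unique.++⁺ (unique-map⁺ (g x) (λ qy qy′ → proj₂ ∘ inj px px qy qy′) qys uys)
               (unique-cartesianProductWith⁺ pxs qys uxs uys)
               disjoint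
    where
    disjoint : ∀ {z} → ¬ (z ∈ map (g x) ys × z ∈ cartesianProductWith g xs ys)
    disjoint (z∈ , z∈′) with ∈-map⁻ (g x) z∈ | ∈-cartesianProductWith⁻ g xs ys z∈′
    ... | y , y∈ys , refl | x′ , y′ , x′∈xs , y′∈ys , eq =
      All.lookup x∉xs x′∈xs
        (proj₁ (inj px (All.lookup pxs x′∈xs) (All.lookup qys y∈ys) (All.lookup qys y′∈ys) eq))

  enumerates-cartesianProductWith : ∀ {xs ys} → Enumerates P xs → Enumerates Q ys →
    Enumerates (λ z → ∃₂ λ x y → P x × Q y × z ≡ g x y) (cartesianProductWith g xs ys)
  enumerates-cartesianProductWith {xs} {ys} e f = record
    { unique   = unique-cartesianProductWith⁺ (All.tabulate (sound e)) (All.tabulate (sound f)) (unique e) (unique f)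
    ; sound    = λ z∈ → let x , y , x∈ , y∈ , z≡ = ∈-cartesianProductWith⁻ g xs ys z∈ in
                        x , y , sound e x∈ , sound f y∈ , z≡
    ; complete = λ { (x , y , px , qy , refl) → ∈-cartesianProductWith⁺ g (complete e px) (complete f qy) }
    }

concatMap-map≡cartesianProductWith : ∀ {A B C : Set} (g : A → B → C) xs ys →
                                     concatMap (λ x → map (g x) ys) xs ≡ cartesianProductWith g xs ys
concatMap-map≡cartesianProductWith g []       ys = refl
concatMap-map≡cartesianProductWith g (x ∷ xs) ys = cong (map (g x) ys ++_) (concatMap-map≡cartesianProductWith g xs ys)

enumerates-upTo : ∀ n → Enumerates (_< n) (upTo n)
enumerates-upTo n = record { unique = Unique.upTo⁺ n ; sound = ∈-upTo⁻ ; complete = ∈-upTo⁺ }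

enumerates-words : ∀ n k → Enumerates (λ w → length w ≡ k × All (InRange n) w) (words n k)
enumerates-words n zero = record
  { unique = [] ∷ [] ; sound = λ { (here refl) → refl , [] } ; complete = λ { {[]} _ → here refl } }
enumerates-words n (suc k) =
  subst (Enumerates _) (sym (concatMap-map≡cartesianProductWith (λ w a → suc a ∷ w) (words n k) (upTo n))) $
  enumerates-resp to from
    (enumerates-cartesianProductWith (λ w a → suc a ∷ w) (λ { _ _ _ _ refl → refl , refl })
      (enumerates-words n k) (enumerates-upTo n))
  where
  to : ∀ {z} → (∃₂ λ w a → (length w ≡ k × All (InRange n) w) × a < n × z ≡ suc a ∷ w) →
       length z ≡ suc k × All (InRange n) z
  to (w , a , (len , range) , a<n , refl) = cong suc len , (s≤s z≤n , a<n) ∷ range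
  from : ∀ {z} → length z ≡ suc k × All (InRange n) z →
         ∃₂ λ w a → (length w ≡ k × All (InRange n) w) × a < n × z ≡ suc a ∷ w
  from {suc a ∷ w} (len , (_ , a<n) ∷ range) = w , a , (suc-injective len , range) , a<n , refl

enumerates-S : ∀ n → Enumerates (IsPerm n) (S n)
enumerates-S n = enumerates-resp (λ ((len , range) , uniq) → isPerm len range uniq)
                                 (λ p → (length≡ p , inRange p) , distinct p)
                                 (enumerates-filter _ (enumerates-words n n))

enumerates-reverse-Sort : ∀ n → Enumerates (AvPerm n) (map reverse (Sort n))
enumerates-reverse-Sort n =
  enumerates-resp to from (enumerates-map reverse (λ _ _ → reverse-injective) (enumerates-filter _ (enumerates-S n)))
  where
  to : ∀ {z} → (∃ λ π → (IsPerm n π × avoids231 (SC321 π) ≡ true) × z ≡ reverse π) → AvPerm n z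
  to (π , (p , sortable) , refl) = isPerm-reverse p , Equivalence.to (sortable⇔avoiding-reverse π) sortable
  from : ∀ {z} → AvPerm n z → ∃ λ π → (IsPerm n π × avoids231 (SC321 π) ≡ true) × z ≡ reverse π
  from {z} (p , av) =
    reverse z ,
    (isPerm-reverse p , Equivalence.from (sortable⇔avoiding-reverse (reverse z)) (subst Avoiding z≡ av)) ,
    z≡
    where
    z≡ : z ≡ reverse (reverse z)
    z≡ = sym (reverse-involutive z)

-- The Motzkin recurrence

motzRev-suc : ∀ k → motzRev (suc k) ≡ M (suc k) ∷ motzRev k
motzRev-suc zero    = refl
motzRev-suc (suc k) = refl

motzRev≡map-M : ∀ k → motzRev k ≡ map M (downFrom (suc k))
motzRev≡map-M zero    = refl
motzRev≡map-M (suc k) = trans (motzRev-suc k) (cong (M (suc k) ∷_) (motzRev≡map-M k))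

downFrom≡map-∸ : ∀ k → downFrom (suc k) ≡ map (k ∸_) (upTo (suc k))
downFrom≡map-∸ zero    = refl
downFrom≡map-∸ (suc k) = cong (suc k ∷_) (begin
  downFrom (suc k)                        ≡⟨ downFrom≡map-∸ k ⟩
  map (k ∸_) (upTo (suc k))               ≡⟨ map-∘ (upTo (suc k)) ⟩
  map (suc k ∸_) (map suc (upTo (suc k))) ≡⟨ cong (map (suc k ∸_)) (map-upTo suc (suc k)) ⟩
  map (suc k ∸_) (applyUpTo suc (suc k))  ∎)
  where open ≡-Reasoning

M-suc-suc : ∀ k → M (suc (suc k)) ≡ M (suc k) + sum (zipWith _*_ (reverse (motzRev k)) (motzRev k))
M-suc-suc k rewrite motzRev-suc k = refl

zipWith-map-map : ∀ {A B C D : Set} (f : B → C → D) (g : A → B) (h : A → C) xs →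
                  zipWith f (map g xs) (map h xs) ≡ map (λ x → f (g x) (h x)) xs
zipWith-map-map f g h []       = refl
zipWith-map-map f g h (x ∷ xs) = cong (f (g x) (h x) ∷_) (zipWith-map-map f g h xs)

motzkinConvolution : ℕ → ℕ → ℕ
motzkinConvolution m l = sum (map (λ i → M i * M (m ∸ suc i)) (upTo l))

motzkinConvolution-suc : ∀ m l → motzkinConvolution m (suc l) ≡ motzkinConvolution m l + M l * M (m ∸ suc l)
motzkinConvolution-suc m l = begin
  sum (map term (upTo (suc l)))               ≡⟨ cong (sum ∘ map term) (sym (upTo-∷ʳ l)) ⟩
  sum (map term (upTo l ++ [ l ]))            ≡⟨ cong sum (map-++ term (upTo l) [ l ]) ⟩
  sum (map term (upTo l) ++ [ term l ])       ≡⟨ sum-++ (map term (upTo l)) [ term l ] ⟩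
  motzkinConvolution m l + (term l + 0)       ≡⟨ cong (motzkinConvolution m l +_) (+-identityʳ (term l)) ⟩
  motzkinConvolution m l + term l             ∎
  where
  open ≡-Reasoning
  term : ℕ → ℕ
  term i = M i * M (m ∸ suc i)

M-suc : ∀ m → M (suc m) ≡ M m + motzkinConvolution m m
M-suc zero    = refl
M-suc (suc k) = trans (M-suc-suc k) (cong (λ products → M (suc k) + sum products) (begin
  zipWith _*_ (reverse (motzRev k)) (motzRev k)    ≡⟨ cong (λ R → zipWith _*_ (reverse R) R) (motzRev≡map-M k) ⟩
  zipWith _*_ (reverse (map M D)) (map M D)        ≡⟨ cong (λ R → zipWith _*_ R (map M D)) reversed ⟩
  zipWith _*_ (map M U) (map M D)                  ≡⟨ cong (zipWith _*_ (map M U) ∘ map M) (downFrom≡map-∸ k) ⟩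
  zipWith _*_ (map M U) (map M (map (k ∸_) U))     ≡⟨ cong (zipWith _*_ (map M U)) (sym (map-∘ U)) ⟩
  zipWith _*_ (map M U) (map (λ i → M (k ∸ i)) U)  ≡⟨ zipWith-map-map _*_ M (λ i → M (k ∸ i)) U ⟩
  map (λ i → M i * M (k ∸ i)) U                    ∎))
  where
  open ≡-Reasoning
  U D : List ℕ
  U = upTo (suc k)
  D = downFrom (suc k)
  reversed : reverse (map M D) ≡ map M U
  reversed = begin
    reverse (map M D)            ≡⟨ sym (reverse-map M D) ⟩
    map M (reverse D)            ≡⟨ cong (map M ∘ reverse) (sym (reverse-upTo (suc k))) ⟩
    map M (reverse (reverse U))  ≡⟨ cong (map M) (reverse-involutive U) ⟩
    map M U                      ∎

++-injective : ∀ {A : Set} (xs ys : List A) {zs ws} → length xs ≡ length ys → xs ++ zs ≡ ys ++ ws →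
               xs ≡ ys × zs ≡ ws
++-injective []       []       _   eq = refl , eq
++-injective (x ∷ xs) (y ∷ ys) len eq with ++-injective xs ys (suc-injective len) (∷-injectiveʳ eq)
... | xs≡ys , zs≡ws = cong₂ _∷_ (∷-injectiveˡ eq) xs≡ys , zs≡ws

length-cartesianProductWith : ∀ {A B C : Set} (g : A → B → C) xs ys →
                              length (cartesianProductWith g xs ys) ≡ length xs * length ys
length-cartesianProductWith g []       ys = refl
length-cartesianProductWith g (x ∷ xs) ys =
  trans (length-++ (map (g x) ys)) (cong₂ _+_ (length-map (g x) ys) (length-cartesianProductWith g xs ys))

oneFirst-injective : ∀ {τ τ′} → oneFirst τ ≡ oneFirst τ′ → τ ≡ τ′
oneFirst-injective = map-injective suc-injective ∘ ∷-injectiveʳ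

peakFirst-injective : ∀ {i ρ ρ′ τ τ′} → length ρ ≡ length ρ′ → peakFirst i ρ τ ≡ peakFirst i ρ′ τ′ →
                      ρ ≡ ρ′ × τ ≡ τ′
peakFirst-injective {i} {ρ} {ρ′} {τ} {τ′} len eq =
  map-injective suc-injective (proj₁ blocks≡) , map-injective (+-cancelˡ-≡ (suc (suc i)) _ _) (proj₂ blocks≡)
  where
  blocks≡ : map suc ρ ≡ map suc ρ′ × map (suc (suc i) +_) τ ≡ map (suc (suc i) +_) τ′
  blocks≡ = ++-injective (map suc ρ) (map suc ρ′) (trans (length-map suc ρ) (trans len (sym (length-map suc ρ′))))
                         (∷-injectiveʳ (∷-injectiveʳ eq))

MotzkinCounted : ℕ → Set
MotzkinCounted n = ∃ λ (xs : List (List ℕ)) → Enumerates (AvPerm n) xs × length xs ≡ M n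

enumerates-AvPerm-0 : Enumerates (AvPerm 0) ([] ∷ [])
enumerates-AvPerm-0 = record
  { unique   = [] ∷ []
  ; sound    = λ { (here refl) → avPerm-[] }
  ; complete = λ av → subst (_∈ [] ∷ []) (sym (avPerm-0⇒[] av)) (here refl)
  }

module _ (m : ℕ) (smaller : ∀ {j} → j < suc m → MotzkinCounted j) where

  enumerate-PeakFirst : ∀ l → l ≤ m → ∃ λ ys → Enumerates (PeakFirst m l) ys × length ys ≡ motzkinConvolution m l
  enumerate-PeakFirst zero    _   = [] , record { unique = [] ; sound = λ () ; complete = λ { (_ , () , _) } } , refl
  enumerate-PeakFirst (suc l) l<m
    with ys , enum-ys , len-ys ← enumerate-PeakFirst l (<⇒≤ l<m)
       | xs , enum-xs , len-xs ← smaller (m<n⇒m<1+n l<m)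
       | zs , enum-zs , len-zs ← smaller (s≤s (m∸n≤m m (suc l))) =
    ys ++ products ,
    enumerates-resp to from
      (enumerates-++ disjoint enum-ys
        (enumerates-cartesianProductWith (peakFirst l)
          (λ (isPerm lenρ _ _ , _) (isPerm lenρ′ _ _ , _) _ _ → peakFirst-injective (trans lenρ (sym lenρ′)))
          enum-xs enum-zs)) ,
    (begin
      length (ys ++ products)                       ≡⟨ length-++ ys ⟩
      length ys + length products                   ≡⟨ cong (length ys +_) (length-cartesianProductWith _ xs zs) ⟩
      length ys + length xs * length zs             ≡⟨ cong₂ _+_ len-ys (cong₂ _*_ len-xs len-zs) ⟩
      motzkinConvolution m l + M l * M (m ∸ suc l)  ≡⟨ sym (motzkinConvolution-suc m l) ⟩
      motzkinConvolution m (suc l)                  ∎)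
    where
    open ≡-Reasoning
    products : List (List ℕ)
    products = cartesianProductWith (peakFirst l) xs zs
    disjoint : ∀ {z} → PeakFirst m l z → ¬ PeakFirstAt m l z
    disjoint (i , i<l , _ , _ , _ , _ , refl) (_ , _ , _ , _ , eq) =
      <-irrefl (suc-injective (suc-injective (∷-injectiveˡ eq))) i<l
    to : ∀ {z} → PeakFirst m l z ⊎ PeakFirstAt m l z → PeakFirst m (suc l) z
    to (inj₁ (i , i<l , rest)) = i , m<n⇒m<1+n i<l , rest
    to (inj₂ rest)             = l , ≤-refl , rest
    from : ∀ {z} → PeakFirst m (suc l) z → PeakFirst m l z ⊎ PeakFirstAt m l z
    from (i , i<1+l , rest) with m<1+n⇒m<n∨m≡n i<1+l
    ... | inj₁ i<l  = inj₁ (i , i<l , rest)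
    ... | inj₂ refl = inj₂ rest

  motzkinCounted-suc : MotzkinCounted (suc m)
  motzkinCounted-suc
    with xs , enum-xs , len-xs ← smaller ≤-refl
       | ys , enum-ys , len-ys ← enumerate-PeakFirst m ≤-refl =
    map oneFirst xs ++ ys ,
    enumerates-resp compose decompose
      (enumerates-++ (λ { (_ , _ , refl) (_ , _ , _ , _ , _ , _ , ()) })
        (enumerates-map oneFirst (λ _ _ → oneFirst-injective) enum-xs) enum-ys) ,
    (begin
      length (map oneFirst xs ++ ys)         ≡⟨ length-++ (map oneFirst xs) ⟩
      length (map oneFirst xs) + length ys   ≡⟨ cong₂ _+_ (trans (length-map oneFirst xs) len-xs) len-ys ⟩
      M m + motzkinConvolution m m           ≡⟨ sym (M-suc m) ⟩
      M (suc m)                              ∎)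
    where open ≡-Reasoning

motzkinCounted : ∀ n → MotzkinCounted n
motzkinCounted = <-rec MotzkinCounted λ where
  zero    _       → [] ∷ [] , enumerates-AvPerm-0 , refl
  (suc m) smaller → motzkinCounted-suc m smaller

corollary6p2 : (n : ℕ) → length (Sort n) ≡ M n
corollary6p2 n with xs , enum-xs , len-xs ← motzkinCounted n = begin
  length (Sort n)               ≡⟨ sym (length-map reverse (Sort n)) ⟩
  length (map reverse (Sort n)) ≡⟨ enumerates-length (enumerates-reverse-Sort n) enum-xs ⟩
  length xs                     ≡⟨ len-xs ⟩
  M n                           ∎
  where open ≡-Reasoning
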